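{- Let $w\in S_n$, let $v\subseteq w$ be a subword of size $m$ with positions $s_1<\cdots<s_m$ and entries $t_1<\cdots<t_m$, and set $u:=\mathrm{perm}(v)$. Then the map $\varphi_v^w:\mathrm{BPD}(w;v)\to\mathrm{mBPD}(u)$, $\varphi_v^w(B)_{i,j}=B_{s_i,t_j}$ ($1\le i,j\le m$), is a bijection.
   Context: Permutations are written in one-line notation. A bumpless pipe dream (BPD) of size $n$ is a tiling of the $n\times n$ grid (rows $1,\dots,n$ from top to bottom, columns $1,\dots,n$ from left to right; $B_{i,j}$ is the tile in row $i$, column $j$) by six tiles: blank, cross (a vertical and a horizontal segment crossing), horizontal segment, vertical segment, r-elbow (joining the south edge to the east edge) and j-elbow (joining the west edge to the north edge), such that the segments form exactly $n$ pipes, each moving only north and east, each entering through the bottom of one column and exiting through the right end of one row, one pipe per column and per row. A pipe entering in column $j$ and exiting in row $i$ is denoted $j\rightarrow i$; the permutation $w_B$ satisfies $w_B(i)=j$ whenever $j\rightarrow i$ is a pipe; $\mathrm{BPD}(w)$ is the set of BPDs with permutation $w$. A pipe $j\rightarrow i$ is removable if the tile at $(i,j)$ is an r-elbow and it is the only r-elbow in row $i$ and in column $j$. A BPD is minimal if it has no removable pipes; $\mathrm{mBPD}(u)$ is the set of minimal BPDs with permutation $u$ (for the empty permutation this is the single empty BPD). A subword $v\subseteq w$ is a subsequence $w(s_1)\cdots w(s_m)$ ($s_1<\cdots<s_m$) of the one-line notation; $\mathrm{perm}(v)\in S_m$ is its standardization. $\mathrm{BPD}(w;v)$ is the set of $B\in\mathrm{BPD}(w)$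 whose set of removable pipes is exactly $\{w(x)\rightarrow x: x\notin\{s_1,\dots,s_m\}\}$. -}

module Defs where

open import Data.Nat using (ℕ; zero; suc)
open import Data.Fin using (Fin; toℕ; _<_)
open import Data.Bool using (Bool; true; false)
open import Data.Maybe using (Maybe; just; nothing)
open import Data.Product using (Σ; ∃; _×_; _,_)
open import Relation.Binary.PropositionalEquality using (_≡_)
open import Relation.Nullary using (¬_)
open import Function using (_⇔_)
open import Function.Definitions using (Injective)

data Tile : Set where
  blank cross horiz vert relbow jelbow : Tile
  -- relbow : joins the south edge to the east edge
  -- jelbow : joins the west edge to the north edge

hasN hasS hasE hasW : Tile → Bool
hasN blank = false
hasN cross = true
hasN horiz = false
hasN vert = true
hasN relbow = false
hasN jelbow = true
hasS blank = false
hasS cross = true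
hasS horiz = false
hasS vert = true
hasS relbow = true
hasS jelbow = false
hasE blank = false
hasE cross = true
hasE horiz = true
hasE vert = false
hasE relbow = true
hasE jelbow = false
hasW blank = false
hasW cross = true
hasW horiz = true
hasW vert = false
hasW relbow = false
hasW jelbow = true

-- A tiling of the n×n grid. Rows/columns are 0-indexed:
-- row 0 is the top row, column 0 the leftmost column.
-- (Paper's B_{i,j} is  B (i-1) (j-1).)
Grid : ℕ → Set
Grid n = Fin n → Fin n → Tile

-- Local conditions making the segments of a tiling form pipes that
-- enter through the bottom of every column and exit through the right
-- end of every row (moving only north/east, never leaving through the
-- top or the left boundary).
record IsBPD {n : ℕ} (B : Grid n) : Set where
  field
    horizMatch : ∀ i j j' → toℕ j' ≡ suc (toℕ j) → hasE (B i j) ≡ hasW (B i j')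
    vertMatch  : ∀ i i' j → toℕ i' ≡ suc (toℕ i) → hasS (B i j) ≡ hasN (B i' j)
    topEmpty   : ∀ i j → toℕ i ≡ 0 → hasN (B i j) ≡ false
    leftEmpty  : ∀ i j → toℕ j ≡ 0 → hasW (B i j) ≡ false
    bottomFull : ∀ i j → suc (toℕ i) ≡ n → hasS (B i j) ≡ true
    rightFull  : ∀ i j → suc (toℕ j) ≡ n → hasE (B i j) ≡ true

data Dir : Set where
  fromS fromW : Dir

data Move : Set where
  north east : Move

out : Tile → Dir → Maybe Move
out cross  fromS = just north
out vert   fromS = just north
out relbow fromS = just east
out cross  fromW = just east
out horiz  fromW = just east
out jelbow fromW = just north
out _      _     = nothing

-- Visits B j r c d : the pipe entering through the bottom of column j
-- passes through tile (r , c), entering it from side d.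
data Visits {n : ℕ} (B : Grid n) (j : Fin n) : Fin n → Fin n → Dir → Set where
  start : ∀ r → suc (toℕ r) ≡ n → Visits B j r j fromS
  goN   : ∀ {r c d} r' → Visits B j r c d → out (B r c) d ≡ just north →
          suc (toℕ r') ≡ toℕ r → Visits B j r' c fromS
  goE   : ∀ {r c d} c' → Visits B j r c d → out (B r c) d ≡ just east →
          toℕ c' ≡ suc (toℕ c) → Visits B j r c' fromW

-- Pipe B j i : there is a pipe j → i (entering column j, exiting row i).
Pipe : {n : ℕ} → Grid n → Fin n → Fin n → Set
Pipe {n} B j i = Σ (Fin n) λ c → Σ Dir λ d →
  Visits B j i c d × suc (toℕ c) ≡ n × out (B i c) d ≡ just east

HasPerm : {n : ℕ} → Grid n → (Fin n → Fin n) → Set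
HasPerm B w = ∀ i → Pipe B (w i) i

Removable : {n : ℕ} → Grid n → (Fin n → Fin n) → Fin n → Set
Removable B w i =
  B i (w i) ≡ relbow ×
  (∀ j → B i j ≡ relbow → j ≡ w i) ×
  (∀ i' → B i' (w i) ≡ relbow → i' ≡ i)

InBPD : {n : ℕ} → (Fin n → Fin n) → Grid n → Set
InBPD w B = IsBPD B × HasPerm B w

InMBPD : {m : ℕ} → (Fin m → Fin m) → Grid m → Set
InMBPD u C = InBPD u C × (∀ i → ¬ Removable C u i)

-- B ∈ BPD(w; v), where v is the subword of w at positions s(0) < ... < s(m-1):
-- the removable pipes of B are exactly the w(x) → x with x not a position of v.
InBPDsub : {n m : ℕ} → (Fin n → Fin n) → (Fin m → Fin n) → Grid n → Set
InBPDsub w s B = InBPD w B × (∀ x → Removable B w x ⇔ (¬ ∃ λ k → s k ≡ x))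

IsPerm : {n : ℕ} → (Fin n → Fin n) → Set
IsPerm w = Injective _≡_ _≡_ w

StrictlyIncreasing : {m n : ℕ} → (Fin m → Fin n) → Set
StrictlyIncreasing f = ∀ a b → a < b → f a < f b

IsStandardization : {m n : ℕ} → (Fin m → Fin n) → (Fin m → Fin m) → Set
IsStandardization v u = ∀ a b → (u a < u b ⇔ v a < v b)

IsSortedEntries : {m n : ℕ} → (Fin m → Fin n) → (Fin m → Fin n) → Set
IsSortedEntries v t =
  StrictlyIncreasing t ×
  (∀ j → ∃ λ k → v k ≡ t j) ×
  (∀ k → ∃ λ j → v k ≡ t j)

φ : {n m : ℕ} → (Fin m → Fin n) → (Fin m → Fin n) → Grid n → Grid m
φ s t B i j = B (s i) (t j)

_≐_ : {n : ℕ} → Grid n → Grid n → Set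
B ≐ B' = ∀ i j → B i j ≡ B' i j

{-# OPTIONS --safe #-}
-- In a row or column of B ∈ BPD(w; v) whose only r-elbow is at one place, a
-- j-elbow is impossible (scanning west/north from it and from the boundary would produce a second
-- r-elbow), so every other tile is straight: blank, cross, horizontal or vertical.  The rows and
-- columns of the removable pipes therefore contain only straight tiles away from the pipes'
-- r-elbows, and straight tiles are transparent: edge bits and pipes pass through them unchanged.
-- Deleting these rows and columns thus yields a bumpless pipe dream whose pipes are restrictions
-- of those of B, so its permutation is u, and it has no removable pipe since such a pipe would be
-- removable in B.  B is recovered from φ B because a straight tile is determined by its south and
-- west edges.  Conversely, for C ∈ mBPD(u) one re-inserts the deleted rows and columns, each
-- deleted row x carrying the hook of the pipe w(x) → x; prescribing all edge bits of the enlarged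
-- grid makes the local matching conditions automatic.
module Submission where

open import Defs
open import Data.Nat as ℕ using (ℕ; zero; suc; _∸_; _+_; z≤n; s≤s)
import Data.Nat.Properties as ℕ
open import Data.Fin using (Fin; toℕ; _<_; _≤_; inject₁; fromℕ; fromℕ<; punchOut)
  renaming (zero to fzero; suc to fsuc)
open import Data.Fin.Properties
  using (toℕ-injective; toℕ<n; toℕ-inject₁; toℕ-fromℕ; toℕ-fromℕ<; any?; _≟_; <-cmp;
         injective⇒≤; punchOut-injective; ≤-antisym)
open import Data.Fin.Induction using (<-wellFounded; >-wellFounded)
open import Induction.WellFounded using (module All)
open import Data.Bool using (Bool; true; false)
open import Data.Maybe using (just)
open import Data.Product using (Σ; ∃; _×_; _,_; proj₁; proj₂)
open import Data.Sum using (_⊎_; inj₁; inj₂; fromInj₁; fromInj₂)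
open import Data.Empty using (⊥-elim)
open import Relation.Binary.PropositionalEquality
open import Relation.Binary.Definitions using (tri<; tri≈; tri>)
open import Relation.Nullary using (¬_; Dec; yes; no; does)
open import Relation.Nullary.Decidable using (dec-true; dec-false; does-⇔)
open import Function using (_∘_; _⇔_; Equivalence; mk⇔)
open import Function.Definitions using (Injective)

predecessor : ∀ {n} (b : Fin n) → toℕ b ≡ 0 ⊎ Σ (Fin n) λ a → suc (toℕ a) ≡ toℕ b
predecessor fzero    = inj₁ refl
predecessor (fsuc a) = inj₂ (inject₁ a , cong suc (toℕ-inject₁ a))

successor : ∀ {n} (b : Fin n) → suc (toℕ b) ≡ n ⊎ Σ (Fin n) λ c → toℕ c ≡ suc (toℕ b)
successor {n} b with suc (toℕ b) ℕ.≟ n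
... | yes last = inj₁ last
... | no ¬last = inj₂ (fromℕ< b<n , toℕ-fromℕ< b<n)
  where b<n = ℕ.≤∧≢⇒< (toℕ<n b) ¬last

lastIndex : ∀ {n} → Fin n → ∃ λ (l : Fin n) → suc (toℕ l) ≡ n
lastIndex {suc n} _ = fromℕ n , cong suc (toℕ-fromℕ n)

≤-last : ∀ {n} {l : Fin n} → suc (toℕ l) ≡ n → ∀ b → b ≤ l
≤-last last b = ℕ.≤-pred (subst (suc (toℕ b) ℕ.≤_) (sym last) (toℕ<n b))

upward-induction : ∀ {n} (P : Fin n → Set) →
  (∀ b → toℕ b ≡ 0 → P b) →
  (∀ a b → suc (toℕ a) ≡ toℕ b → P a → P b) →
  ∀ b → P b
upward-induction P first step = All.wfRec <-wellFounded _ P go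
  where
  go : ∀ b → (∀ {a} → a < b → P a) → P b
  go b ih with predecessor b
  ... | inj₁ b≡0 = first b b≡0
  ... | inj₂ (a , a+1≡b) = step a b a+1≡b (ih (ℕ.≤-reflexive a+1≡b))

downward-induction : ∀ {n} (P : Fin n → Set) →
  (∀ b → suc (toℕ b) ≡ n → P b) →
  (∀ a b → suc (toℕ a) ≡ toℕ b → P b → P a) →
  ∀ b → P b
downward-induction P last step = All.wfRec >-wellFounded _ P go
  where
  go : ∀ a → (∀ {b} → a < b → P b) → P a
  go a ih with successor a
  ... | inj₁ a-last = last a a-last
  ... | inj₂ (b , b≡a+1) = step a b (sym b≡a+1) (ih (ℕ.≤-reflexive (sym b≡a+1)))

<-predecessor : ∀ {n} {a p b : Fin n} → suc (toℕ p) ≡ toℕ b → a < b → a < p ⊎ a ≡ p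
<-predecessor p+1≡b a<b with ℕ.m≤n⇒m<n∨m≡n (ℕ.≤-pred (subst (_ ℕ.<_) (sym p+1≡b) a<b))
... | inj₁ a<p = inj₁ a<p
... | inj₂ a≡p = inj₂ (toℕ-injective a≡p)

>-successor : ∀ {n} {a q b : Fin n} → toℕ q ≡ suc (toℕ a) → a < b → q < b ⊎ q ≡ b
>-successor q≡a+1 a<b with ℕ.m≤n⇒m<n∨m≡n (subst (ℕ._≤ _) (sym q≡a+1) a<b)
... | inj₁ q<b = inj₁ q<b
... | inj₂ q≡b = inj₂ (toℕ-injective q≡b)

injective⇒surjective : ∀ {n} (f : Fin n → Fin n) → Injective _≡_ _≡_ f →
  ∀ y → ∃ λ x → f x ≡ y
injective⇒surjective {zero}  f f-inj ()
injective⇒surjective {suc n} f f-inj y with any? (λ x → f x ≟ y)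
... | yes hit = hit
... | no miss = ⊥-elim (ℕ.<-irrefl refl (injective⇒≤ g-inj))
  where
  y≢f : ∀ x → y ≢ f x
  y≢f x y≡fx = miss (x , sym y≡fx)
  g : Fin (suc n) → Fin n
  g x = punchOut (y≢f x)
  g-inj : Injective _≡_ _≡_ g
  g-inj {a} {b} e = f-inj (punchOut-injective (y≢f a) (y≢f b) e)

module StrictlyIncreasingMap {m n : ℕ} (f : Fin m → Fin n) (f-inc : StrictlyIncreasing f) where

  reflects-< : ∀ {a b} → f a < f b → a < b
  reflects-< {a} {b} fa<fb with <-cmp a b
  ... | tri< a<b _ _ = a<b
  ... | tri≈ _ refl _ = ⊥-elim (ℕ.<-irrefl refl fa<fb)
  ... | tri> _ _ b<a = ⊥-elim (ℕ.<-asym fa<fb (f-inc _ _ b<a))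

  reflects-≤ : ∀ {a b} → f a ≤ f b → a ≤ b
  reflects-≤ {a} {b} fa≤fb with toℕ a ℕ.≤? toℕ b
  ... | yes a≤b = a≤b
  ... | no a≰b = ⊥-elim (ℕ.<⇒≱ (f-inc _ _ (ℕ.≰⇒> a≰b)) fa≤fb)

  injective : Injective _≡_ _≡_ f
  injective {a} {b} fa≡fb with <-cmp a b
  ... | tri< a<b _ _ = ⊥-elim (ℕ.<-irrefl (cong toℕ fa≡fb) (f-inc _ _ a<b))
  ... | tri≈ _ a≡b _ = a≡b
  ... | tri> _ _ b<a = ⊥-elim (ℕ.<-irrefl (cong toℕ (sym fa≡fb)) (f-inc _ _ b<a))

  ∉image-between : ∀ {a b} → suc (toℕ a) ≡ toℕ b →
    ∀ {x} → f a < x → x < f b → ¬ ∃ λ k → f k ≡ x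
  ∉image-between a+1≡b fa<x x<fb (k , refl) =
    ℕ.<⇒≱ (reflects-< fa<x) (ℕ.≤-pred (subst (suc (toℕ k) ℕ.≤_) (sym a+1≡b) (reflects-< x<fb)))

  ∉image-after-last : ∀ {a} → suc (toℕ a) ≡ m → ∀ {x} → f a < x → ¬ ∃ λ k → f k ≡ x
  ∉image-after-last a-last fa<x (k , refl) =
    ℕ.<⇒≱ (toℕ<n k) (subst (ℕ._≤ toℕ k) a-last (reflects-< fa<x))

  ∉image-before-first : ∀ {a} → toℕ a ≡ 0 → ∀ {x} → x < f a → ¬ ∃ λ k → f k ≡ x
  ∉image-before-first a≡0 x<fa (k , refl) = ℕ.n≮0 (subst (toℕ k ℕ.<_) a≡0 (reflects-< x<fa))

strictlyIncreasing⇒inflationary : ∀ {m} (h : Fin m → Fin m) → StrictlyIncreasing h →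
  ∀ x → x ≤ h x
strictlyIncreasing⇒inflationary h h-inc = upward-induction (λ x → x ≤ h x)
  (λ x x≡0 → subst (ℕ._≤ toℕ (h x)) (sym x≡0) z≤n)
  (λ a b a+1≡b a≤ha → subst (ℕ._≤ toℕ (h b)) a+1≡b
     (ℕ.≤-<-trans a≤ha (h-inc a b (ℕ.≤-reflexive a+1≡b))))

module _ {m : ℕ} (f g : Fin m → Fin m) (f-inj : Injective _≡_ _≡_ f)
         (f<⇒g< : ∀ a b → f a < f b → g a < g b) where

  private
    f⁻¹ : Fin m → Fin m
    f⁻¹ y = proj₁ (injective⇒surjective f f-inj y)

    f∘f⁻¹ : ∀ y → f (f⁻¹ y) ≡ y
    f∘f⁻¹ y = proj₂ (injective⇒surjective f f-inj y)

    g∘f⁻¹-increasing : StrictlyIncreasing (g ∘ f⁻¹)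
    g∘f⁻¹-increasing y y′ y<y′ =
      f<⇒g< _ _ (subst₂ _<_ (sym (f∘f⁻¹ y)) (sym (f∘f⁻¹ y′)) y<y′)

  order-preserving⇒≤ : ∀ a → f a ≤ g a
  order-preserving⇒≤ a = subst (λ z → f a ≤ g z) (f-inj (f∘f⁻¹ (f a)))
    (strictlyIncreasing⇒inflationary (g ∘ f⁻¹) g∘f⁻¹-increasing (f a))

same-order⇒≗ : ∀ {m} (f g : Fin m → Fin m) → Injective _≡_ _≡_ f → Injective _≡_ _≡_ g →
  (∀ a b → f a < f b → g a < g b) → (∀ a b → g a < g b → f a < f b) → ∀ a → f a ≡ g a
same-order⇒≗ f g f-inj g-inj f<⇒g< g<⇒f< a =
  ≤-antisym (order-preserving⇒≤ f g f-inj f<⇒g< a) (order-preserving⇒≤ g f g-inj g<⇒f< a)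

-- Straight tiles

false≢true : false ≢ true
false≢true ()

data Straight : Tile → Set where
  straight-blank : Straight blank
  straight-cross : Straight cross
  straight-horiz : Straight horiz
  straight-vert  : Straight vert

straight⇒E≡W : ∀ {x} → Straight x → hasE x ≡ hasW x
straight⇒E≡W straight-blank = refl
straight⇒E≡W straight-cross = refl
straight⇒E≡W straight-horiz = refl
straight⇒E≡W straight-vert  = refl

straight⇒S≡N : ∀ {x} → Straight x → hasS x ≡ hasN x
straight⇒S≡N straight-blank = refl
straight⇒S≡N straight-cross = refl
straight⇒S≡N straight-horiz = refl
straight⇒S≡N straight-vert  = refl

E≡W⇒straight : ∀ x → hasE x ≡ hasW x → Straight x
E≡W⇒straight blank  _ = straight-blank
E≡W⇒straight cross  _ = straight-cross
E≡W⇒straight horiz  _ = straight-horiz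
E≡W⇒straight vert   _ = straight-vert
E≡W⇒straight relbow ()
E≡W⇒straight jelbow ()

S≡N⇒straight : ∀ x → hasS x ≡ hasN x → Straight x
S≡N⇒straight blank  _ = straight-blank
S≡N⇒straight cross  _ = straight-cross
S≡N⇒straight horiz  _ = straight-horiz
S≡N⇒straight vert   _ = straight-vert
S≡N⇒straight relbow ()
S≡N⇒straight jelbow ()

straight⇒≢relbow : ∀ {x} → Straight x → x ≢ relbow
straight⇒≢relbow straight-blank ()
straight⇒≢relbow straight-cross ()
straight⇒≢relbow straight-horiz ()
straight⇒≢relbow straight-vert  ()

E∧¬W⇒relbow : ∀ x → hasE x ≡ true → hasW x ≡ false → x ≡ relbow
E∧¬W⇒relbow cross  _  ()
E∧¬W⇒relbow horiz  _  ()
E∧¬W⇒relbow relbow _  _ = refl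
E∧¬W⇒relbow blank  ()
E∧¬W⇒relbow vert   ()
E∧¬W⇒relbow jelbow ()

S∧¬N⇒relbow : ∀ x → hasS x ≡ true → hasN x ≡ false → x ≡ relbow
S∧¬N⇒relbow cross  _  ()
S∧¬N⇒relbow vert   _  ()
S∧¬N⇒relbow relbow _  _ = refl
S∧¬N⇒relbow blank  ()
S∧¬N⇒relbow horiz  ()
S∧¬N⇒relbow jelbow ()

straight-determined-by-S-W : ∀ {x y} → Straight x → Straight y →
  hasS x ≡ hasS y → hasW x ≡ hasW y → x ≡ y
straight-determined-by-S-W straight-blank straight-blank _ _ = refl
straight-determined-by-S-W straight-cross straight-cross _ _ = refl
straight-determined-by-S-W straight-horiz straight-horiz _ _ = refl
straight-determined-by-S-W straight-vert  straight-vert  _ _ = refl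
straight-determined-by-S-W straight-blank straight-cross () _
straight-determined-by-S-W straight-blank straight-horiz _ ()
straight-determined-by-S-W straight-blank straight-vert  () _
straight-determined-by-S-W straight-cross straight-blank () _
straight-determined-by-S-W straight-cross straight-horiz () _
straight-determined-by-S-W straight-cross straight-vert  _ ()
straight-determined-by-S-W straight-horiz straight-blank _ ()
straight-determined-by-S-W straight-horiz straight-cross () _
straight-determined-by-S-W straight-horiz straight-vert  () _
straight-determined-by-S-W straight-vert  straight-blank () _
straight-determined-by-S-W straight-vert  straight-cross _ ()
straight-determined-by-S-W straight-vert  straight-horiz () _

enteredBy : Dir → Tile → Bool
enteredBy fromS = hasS
enteredBy fromW = hasW

straight-passes-north : ∀ {x} → Straight x → hasS x ≡ true → out x fromS ≡ just north
straight-passes-north straight-cross _ = refl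
straight-passes-north straight-vert  _ = refl
straight-passes-north straight-blank ()
straight-passes-north straight-horiz ()

straight-passes-east : ∀ {x} → Straight x → hasW x ≡ true → out x fromW ≡ just east
straight-passes-east straight-cross _ = refl
straight-passes-east straight-horiz _ = refl
straight-passes-east straight-blank ()
straight-passes-east straight-vert  ()

out-defined : ∀ x d → enteredBy d x ≡ true → ∃ λ mv → out x d ≡ just mv
out-defined cross  fromS _ = north , refl
out-defined vert   fromS _ = north , refl
out-defined relbow fromS _ = east , refl
out-defined cross  fromW _ = east , refl
out-defined horiz  fromW _ = east , refl
out-defined jelbow fromW _ = north , refl
out-defined blank  fromS ()
out-defined horiz  fromS ()
out-defined jelbow fromS ()
out-defined blank  fromW ()
out-defined vert   fromW ()
out-defined relbow fromW ()

out-north⇒N : ∀ x d → out x d ≡ just north → hasN x ≡ true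
out-north⇒N cross  fromS _ = refl
out-north⇒N vert   fromS _ = refl
out-north⇒N jelbow fromW _ = refl
out-north⇒N blank  fromS ()
out-north⇒N blank  fromW ()
out-north⇒N cross  fromW ()
out-north⇒N horiz  fromS ()
out-north⇒N horiz  fromW ()
out-north⇒N vert   fromW ()
out-north⇒N relbow fromS ()
out-north⇒N relbow fromW ()
out-north⇒N jelbow fromS ()

out-east⇒E : ∀ x d → out x d ≡ just east → hasE x ≡ true
out-east⇒E cross  fromW _ = refl
out-east⇒E horiz  fromW _ = refl
out-east⇒E relbow fromS _ = refl
out-east⇒E blank  fromS ()
out-east⇒E blank  fromW ()
out-east⇒E cross  fromS ()
out-east⇒E horiz  fromS ()
out-east⇒E vert   fromS ()
out-east⇒E vert   fromW ()
out-east⇒E relbow fromW ()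
out-east⇒E jelbow fromS ()
out-east⇒E jelbow fromW ()

out-injective : ∀ x d d′ {mv} → out x d ≡ just mv → out x d′ ≡ just mv → d ≡ d′
out-injective x      fromS fromS _ _ = refl
out-injective x      fromW fromW _ _ = refl
out-injective cross  fromS fromW refl ()
out-injective cross  fromW fromS refl ()
out-injective blank  fromS fromW ()
out-injective blank  fromW fromS ()
out-injective horiz  fromS fromW ()
out-injective horiz  fromW fromS _ ()
out-injective vert   fromS fromW _ ()
out-injective vert   fromW fromS ()
out-injective relbow fromS fromW _ ()
out-injective relbow fromW fromS ()
out-injective jelbow fromS fromW ()
out-injective jelbow fromW fromS _ ()

-- Rows and columns as lines of tiles

record Line (n : ℕ) : Set where
  field
    enters exits : Fin n → Bool
    link         : ∀ a b → suc (toℕ a) ≡ toℕ b → exits a ≡ enters b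
    first-closed : ∀ b → toℕ b ≡ 0 → enters b ≡ false
    last-open    : ∀ b → suc (toℕ b) ≡ n → exits b ≡ true

module LineProperties {n : ℕ} (L : Line n) where
  open Line L

  Transparent : Fin n → Set
  Transparent c = exits c ≡ enters c

  Opens : Fin n → Set
  Opens c = exits c ≡ true × enters c ≡ false

  link-across : ∀ {a b} → a < b → (∀ c → a < c → c < b → Transparent c) → exits a ≡ enters b
  link-across {a} {b} = upward-induction P
    (λ b b≡0 a<b _ → ⊥-elim (ℕ.n≮0 (subst (toℕ a ℕ.<_) b≡0 a<b))) step b
    where
    P : Fin n → Set
    P b = a < b → (∀ c → a < c → c < b → Transparent c) → exits a ≡ enters b
    step : ∀ p b → suc (toℕ p) ≡ toℕ b → P p → P b
    step p b p+1≡b ih a<b transparent with <-predecessor p+1≡b a<b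
    ... | inj₂ refl = link a b p+1≡b
    ... | inj₁ a<p = begin
      exits a  ≡⟨ ih a<p (λ c a<c c<p → transparent c a<c (ℕ.<-trans c<p p<b)) ⟩
      enters p ≡⟨ transparent p a<p p<b ⟨
      exits p  ≡⟨ link p b p+1≡b ⟩
      enters b ∎
      where
      open ≡-Reasoning
      p<b = ℕ.≤-reflexive p+1≡b

  closed-before : ∀ b → (∀ c → c < b → Transparent c) → enters b ≡ false
  closed-before = upward-induction _ (λ b b≡0 _ → first-closed b b≡0)
    λ p b p+1≡b ih transparent → let p<b = ℕ.≤-reflexive p+1≡b in begin
      enters b ≡⟨ link p b p+1≡b ⟨
      exits p  ≡⟨ transparent p p<b ⟩
      enters p ≡⟨ ih (λ c c<p → transparent c (ℕ.<-trans c<p p<b)) ⟩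
      false    ∎
    where open ≡-Reasoning

  open-after : ∀ b → (∀ c → b < c → Transparent c) → exits b ≡ true
  open-after = downward-induction _ (λ b b-last _ → last-open b b-last)
    λ a b a+1≡b ih transparent → let a<b = ℕ.≤-reflexive a+1≡b in begin
      exits a  ≡⟨ link a b a+1≡b ⟩
      enters b ≡⟨ transparent b a<b ⟨
      exits b  ≡⟨ ih (λ c b<c → transparent c (ℕ.<-trans a<b b<c)) ⟩
      true     ∎
    where open ≡-Reasoning

  OpenRunTo : Fin n → Set
  OpenRunTo b = ∃ λ a → a ≤ b × Opens a × (∀ c → a ≤ c → c ≤ b → exits c ≡ true)

  opener-at-or-before : ∀ b → exits b ≡ true → OpenRunTo b
  opener-at-or-before = upward-induction (λ b → exits b ≡ true → OpenRunTo b) first step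
    where
    here : ∀ b → exits b ≡ true → enters b ≡ false → OpenRunTo b
    here b eb nb = b , ℕ.≤-refl , (eb , nb) ,
      λ c b≤c c≤b → subst (λ x → exits x ≡ true) (≤-antisym b≤c c≤b) eb
    first : ∀ b → toℕ b ≡ 0 → exits b ≡ true → OpenRunTo b
    first b b≡0 eb = here b eb (first-closed b b≡0)
    step : ∀ p b → suc (toℕ p) ≡ toℕ b →
      (exits p ≡ true → OpenRunTo p) → exits b ≡ true → OpenRunTo b
    step p b p+1≡b ih eb with enters b in nb
    ... | false = here b eb nb
    ... | true with ih (trans (link p b p+1≡b) nb)
    ...   | a , a≤p , opens , run =
      a , ℕ.≤-trans a≤p (ℕ.<⇒≤ (ℕ.≤-reflexive p+1≡b)) , opens , run′
      where
      run′ : ∀ c → a ≤ c → c ≤ b → exits c ≡ true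
      run′ c a≤c c≤b with ℕ.m≤n⇒m<n∨m≡n c≤b
      ... | inj₁ c<b = run c a≤c (ℕ.≤-pred (subst (suc (toℕ c) ℕ.≤_) (sym p+1≡b) c<b))
      ... | inj₂ c≡b = subst (λ x → exits x ≡ true) (toℕ-injective (sym c≡b)) eb

  single-opener⇒transparent : ∀ c₀ → (∀ c → Opens c → c ≡ c₀) → ∀ c → c ≢ c₀ → Transparent c
  single-opener⇒transparent c₀ unique c c≢c₀ with exits c in ex | enters c in en
  ... | false | false = refl
  ... | true  | true  = refl
  ... | true  | false = ⊥-elim (c≢c₀ (unique c (ex , en)))
  ... | false | true  = ⊥-elim (false≢true (trans (sym ex) exits-c))
    where
    c₀<c : c₀ < c
    c₀<c with predecessor c
    ... | inj₁ c≡0 = ⊥-elim (false≢true (trans (sym (first-closed c c≡0)) en))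
    ... | inj₂ (p , p+1≡c) with opener-at-or-before p (trans (link p c p+1≡c) en)
    ...   | a , a≤p , opens , _ =
      subst (_< c) (unique a opens) (ℕ.≤-<-trans a≤p (ℕ.≤-reflexive p+1≡c))
    exits-c : exits c ≡ true
    exits-c with lastIndex c
    ... | l , l-last with opener-at-or-before l (last-open l l-last)
    ...   | a , _ , opens , run =
      run c (subst (_≤ c) (sym (unique a opens)) (ℕ.<⇒≤ c₀<c)) (≤-last l-last c)

module BPDProperties {n : ℕ} (B : Grid n) (bpd : IsBPD B) where
  open IsBPD bpd

  row : Fin n → Line n
  row r = record
    { enters       = λ c → hasW (B r c)
    ; exits        = λ c → hasE (B r c)
    ; link         = λ a b a+1≡b → horizMatch r a b (sym a+1≡b)
    ; first-closed = leftEmpty r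
    ; last-open    = rightFull r
    }

  column : Fin n → Line n
  column c = record
    { enters       = λ r → hasN (B r c)
    ; exits        = λ r → hasS (B r c)
    ; link         = λ a b a+1≡b → vertMatch a b c (sym a+1≡b)
    ; first-closed = λ r → topEmpty r c
    ; last-open    = λ r → bottomFull r c
    }

  straight-off-unique-relbow-in-row : ∀ r c₀ → (∀ c → B r c ≡ relbow → c ≡ c₀) →
    ∀ c → c ≢ c₀ → Straight (B r c)
  straight-off-unique-relbow-in-row r c₀ unique c c≢c₀ = E≡W⇒straight _
    (LineProperties.single-opener⇒transparent (row r) c₀
      (λ c (e , ¬w) → unique c (E∧¬W⇒relbow _ e ¬w)) c c≢c₀)

  straight-off-unique-relbow-in-column : ∀ c r₀ → (∀ r → B r c ≡ relbow → r ≡ r₀) →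
    ∀ r → r ≢ r₀ → Straight (B r c)
  straight-off-unique-relbow-in-column c r₀ unique r r≢r₀ = S≡N⇒straight _
    (LineProperties.single-opener⇒transparent (column c) r₀
      (λ r (s , ¬n) → unique r (S∧¬N⇒relbow _ s ¬n)) r r≢r₀)

  visits⇒entered : ∀ {j r c d} → Visits B j r c d → enteredBy d (B r c) ≡ true
  visits⇒entered (start r r-last)            = bottomFull r _ r-last
  visits⇒entered (goN {r} {c} r′ _ o r′+1≡r) = trans (vertMatch r′ r c (sym r′+1≡r)) (out-north⇒N _ _ o)
  visits⇒entered (goE {r} {c} c′ _ o c′≡c+1) = trans (sym (horizMatch r c c′ c′≡c+1)) (out-east⇒E _ _ o)

  visits-source-unique : ∀ {j₁ j₂ r c d} → Visits B j₁ r c d → Visits B j₂ r c d → j₁ ≡ j₂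
  visits-source-unique (start r _) (start r _) = refl
  visits-source-unique (start r r-last) (goN {r₂} r _ _ r+1≡r₂) =
    ⊥-elim (ℕ.<-irrefl (trans (sym r+1≡r₂) r-last) (toℕ<n r₂))
  visits-source-unique (goN {r₁} r _ _ r+1≡r₁) (start r r-last) =
    ⊥-elim (ℕ.<-irrefl (trans (sym r+1≡r₁) r-last) (toℕ<n r₁))
  visits-source-unique (goN {r₁} {c} {d₁} r v o e) (goN {r₂} {c} {d₂} r v′ o′ e′)
    with toℕ-injective {i = r₁} {j = r₂} (trans (sym e) e′)
  ... | refl with out-injective _ d₁ d₂ o o′
  ... | refl = visits-source-unique v v′
  visits-source-unique (goE {r} {c₁} {d₁} c v o e) (goE {r} {c₂} {d₂} c v′ o′ e′)
    with toℕ-injective {i = c₁} {j = c₂} (ℕ.suc-injective (trans (sym e) e′))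
  ... | refl with out-injective _ d₁ d₂ o o′
  ... | refl = visits-source-unique v v′

  pipe-source-unique : ∀ {j₁ j₂ i} → Pipe B j₁ i → Pipe B j₂ i → j₁ ≡ j₂
  pipe-source-unique (c₁ , d₁ , v₁ , last₁ , o₁) (c₂ , d₂ , v₂ , last₂ , o₂)
    with toℕ-injective {i = c₁} {j = c₂} (ℕ.suc-injective (trans last₁ (sym last₂)))
  ... | refl with out-injective _ d₁ d₂ o₁ o₂
  ... | refl = visits-source-unique v₁ v₂

  pipe-exists : ∀ j → ∃ λ i → Pipe B j i
  pipe-exists j with lastIndex j
  ... | l , l-last = follow _ (start l l-last) ℕ.≤-refl
    where
    follow : ∀ fuel {r c d} → Visits B j r c d → toℕ r + (n ∸ toℕ c) ℕ.< fuel →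
      ∃ λ i → Pipe B j i
    follow (suc fuel) {r} {c} {d} v bound with out-defined (B r c) d (visits⇒entered v)
    ... | north , o with predecessor r
    ...   | inj₁ r≡0 = ⊥-elim (false≢true (trans (sym (topEmpty r c r≡0)) (out-north⇒N _ _ o)))
    ...   | inj₂ (r′ , r′+1≡r) = follow fuel (goN r′ v o r′+1≡r)
            (ℕ.<-≤-trans (ℕ.+-monoˡ-< (n ∸ toℕ c) (ℕ.≤-reflexive r′+1≡r)) (ℕ.≤-pred bound))
    follow (suc fuel) {r} {c} {d} v bound | east , o with successor c
    ...   | inj₁ c-last = r , c , d , v , c-last , o
    ...   | inj₂ (c′ , c′≡c+1) = follow fuel (goE c′ v o c′≡c+1)
            (ℕ.<-≤-trans (ℕ.+-monoʳ-< (toℕ r) n∸c′<n∸c) (ℕ.≤-pred bound))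
      where
      n∸c′<n∸c = ℕ.∸-monoʳ-< (ℕ.≤-reflexive (sym c′≡c+1)) (ℕ.<⇒≤ (toℕ<n c′))

  climb : ∀ {j r c d} → Visits B j r c d → out (B r c) d ≡ just north →
    ∀ a → a < r → (∀ r′ → a < r′ → r′ < r → Straight (B r′ c)) → Visits B j a c fromS
  climb {j} {r} {c} v o = downward-induction P
    (λ a a-last a<r _ → ⊥-elim (ℕ.<⇒≱ a<r (≤-last a-last r))) step
    where
    P : Fin n → Set
    P a = a < r → (∀ r′ → a < r′ → r′ < r → Straight (B r′ c)) → Visits B j a c fromS
    step : ∀ a b → suc (toℕ a) ≡ toℕ b → P b → P a
    step a b a+1≡b ih a<r straight with >-successor (sym a+1≡b) a<r
    ... | inj₂ refl = goN a v o a+1≡b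
    ... | inj₁ b<r =
      goN a vb (straight-passes-north (straight b a<b b<r) (visits⇒entered vb)) a+1≡b
      where
      a<b = ℕ.≤-reflexive a+1≡b
      vb = ih b<r (λ r′ b<r′ → straight r′ (ℕ.<-trans a<b b<r′))

  advance : ∀ {j r c d} → Visits B j r c d → out (B r c) d ≡ just east →
    ∀ b → c < b → (∀ c′ → c < c′ → c′ < b → Straight (B r c′)) → Visits B j r b fromW
  advance {j} {r} {c} v o = upward-induction P
    (λ b b≡0 c<b _ → ⊥-elim (ℕ.n≮0 (subst (toℕ c ℕ.<_) b≡0 c<b))) step
    where
    P : Fin n → Set
    P b = c < b → (∀ c′ → c < c′ → c′ < b → Straight (B r c′)) → Visits B j r b fromW
    step : ∀ p b → suc (toℕ p) ≡ toℕ b → P p → P b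
    step p b p+1≡b ih c<b straight with <-predecessor p+1≡b c<b
    ... | inj₂ refl = goE b v o (sym p+1≡b)
    ... | inj₁ c<p =
      goE b vp (straight-passes-east (straight p c<p p<b) (visits⇒entered vp)) (sym p+1≡b)
      where
      p<b = ℕ.≤-reflexive p+1≡b
      vp = ih c<p (λ c′ c<c′ c′<p → straight c′ c<c′ (ℕ.<-trans c′<p p<b))

  enter-from-bottom : ∀ j a → (∀ r → a < r → Straight (B r j)) → Visits B j a j fromS
  enter-from-bottom j = downward-induction _ (λ a a-last _ → start a a-last)
    λ a b a+1≡b ih straight →
      let a<b = ℕ.≤-reflexive a+1≡b
          vb  = ih (λ r b<r → straight r (ℕ.<-trans a<b b<r))
      in goN a vb (straight-passes-north (straight b a<b) (visits⇒entered vb)) a+1≡b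

  exit-east : ∀ {j r} c {d} → Visits B j r c d → out (B r c) d ≡ just east →
    (∀ c′ → c < c′ → Straight (B r c′)) → Pipe B j r
  exit-east {j} {r} = downward-induction P (λ c c-last v o _ → c , _ , v , c-last , o) step
    where
    P : Fin n → Set
    P c = ∀ {d} → Visits B j r c d → out (B r c) d ≡ just east →
          (∀ c′ → c < c′ → Straight (B r c′)) → Pipe B j r
    step : ∀ a b → suc (toℕ a) ≡ toℕ b → P b → P a
    step a b a+1≡b ih v o straight =
      ih vb (straight-passes-east (straight b a<b) (visits⇒entered vb))
        (λ c′ b<c′ → straight c′ (ℕ.<-trans a<b b<c′))
      where
      a<b = ℕ.≤-reflexive a+1≡b
      vb = goE b v o (sym a+1≡b)

module Compression {n m : ℕ} (B : Grid n) (bpd : IsBPD B) {s t : Fin m → Fin n}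
  (s-inc : StrictlyIncreasing s) (t-inc : StrictlyIncreasing t)
  (straight-in-deleted-row : ∀ r j → ¬ (∃ λ i → s i ≡ r) → Straight (B r (t j)))
  (straight-in-deleted-column : ∀ i c → ¬ (∃ λ j → t j ≡ c) → Straight (B (s i) c)) where
  open BPDProperties B bpd
  private
    module S = StrictlyIncreasingMap s s-inc
    module T = StrictlyIncreasingMap t t-inc

    transparent-in-row : ∀ i c → ¬ (∃ λ j → t j ≡ c) → hasE (B (s i) c) ≡ hasW (B (s i) c)
    transparent-in-row i c c-deleted = straight⇒E≡W (straight-in-deleted-column i c c-deleted)

    transparent-in-column : ∀ r j → ¬ (∃ λ i → s i ≡ r) → hasS (B r (t j)) ≡ hasN (B r (t j))
    transparent-in-column r j r-deleted = straight⇒S≡N (straight-in-deleted-row r j r-deleted)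

  φ-isBPD : IsBPD (φ s t B)
  φ-isBPD = record
    { horizMatch = λ i j j′ j′≡j+1 →
        LineProperties.link-across (row (s i)) (t-inc j j′ (ℕ.≤-reflexive (sym j′≡j+1)))
          λ c tj<c c<tj′ → transparent-in-row i c (T.∉image-between (sym j′≡j+1) tj<c c<tj′)
    ; vertMatch = λ i i′ j i′≡i+1 →
        LineProperties.link-across (column (t j)) (s-inc i i′ (ℕ.≤-reflexive (sym i′≡i+1)))
          λ r si<r r<si′ → transparent-in-column r j (S.∉image-between (sym i′≡i+1) si<r r<si′)
    ; topEmpty = λ i j i≡0 → LineProperties.closed-before (column (t j)) (s i)
        λ r r<si → transparent-in-column r j (S.∉image-before-first i≡0 r<si)
    ; leftEmpty = λ i j j≡0 → LineProperties.closed-before (row (s i)) (t j)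
        λ c c<tj → transparent-in-row i c (T.∉image-before-first j≡0 c<tj)
    ; bottomFull = λ i j i-last → LineProperties.open-after (column (t j)) (s i)
        λ r si<r → transparent-in-column r j (S.∉image-after-last i-last si<r)
    ; rightFull = λ i j j-last → LineProperties.open-after (row (s i)) (t j)
        λ c tj<c → transparent-in-row i c (T.∉image-after-last j-last tj<c)
    }

  module _ (C : Grid m) (φ≐C : φ s t B ≐ C) where

    lift-visits : ∀ {j₀ i j d} → Visits C j₀ i j d → Visits B (t j₀) (s i) (t j) d
    lift-visits {j₀} (start i i-last) = enter-from-bottom (t j₀) (s i)
      λ r si<r → straight-in-deleted-row r j₀ (S.∉image-after-last i-last si<r)
    lift-visits (goN {i} {j} {d} i′ v o i′+1≡i) =
      climb (lift-visits v) (subst (λ x → out x d ≡ just north) (sym (φ≐C i j)) o)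
        (s i′) (s-inc i′ i (ℕ.≤-reflexive i′+1≡i))
        λ r si′<r r<si → straight-in-deleted-row r j (S.∉image-between i′+1≡i si′<r r<si)
    lift-visits (goE {i} {j} {d} j′ v o j′≡j+1) =
      advance (lift-visits v) (subst (λ x → out x d ≡ just east) (sym (φ≐C i j)) o)
        (t j′) (t-inc j j′ (ℕ.≤-reflexive (sym j′≡j+1)))
        λ c tj<c c<tj′ → straight-in-deleted-column i c (T.∉image-between (sym j′≡j+1) tj<c c<tj′)

    lift-pipe : ∀ {j₀ i} → Pipe C j₀ i → Pipe B (t j₀) (s i)
    lift-pipe {i = i} (c , d , v , c-last , o) =
      exit-east (t c) (lift-visits v) (subst (λ x → out x d ≡ just east) (sym (φ≐C i c)) o)
        λ c′ tc<c′ → straight-in-deleted-column i c′ (T.∉image-after-last c-last tc<c′)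

≐-if-equal-or-straight : ∀ {n} {B B′ : Grid n} → IsBPD B → IsBPD B′ →
  (∀ r c → B r c ≡ B′ r c ⊎ Straight (B r c) × Straight (B′ r c)) → B ≐ B′
≐-if-equal-or-straight {n} {B} {B′} bpd bpd′ same-or-straight =
  downward-induction (λ r → ∀ c → B r c ≡ B′ r c)
    (λ r r-last → row-agrees r λ c → trans (bottomFull r c r-last) (sym (bottomFull′ r c r-last)))
    (λ r r′ r+1≡r′ ih → row-agrees r λ c → begin
       hasS (B r c)    ≡⟨ vertMatch r r′ c (sym r+1≡r′) ⟩
       hasN (B r′ c)   ≡⟨ cong hasN (ih c) ⟩
       hasN (B′ r′ c)  ≡⟨ vertMatch′ r r′ c (sym r+1≡r′) ⟨
       hasS (B′ r c)   ∎)
  where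
  open IsBPD bpd
  open IsBPD bpd′ using () renaming (horizMatch to horizMatch′; vertMatch to vertMatch′;
                                     leftEmpty to leftEmpty′; bottomFull to bottomFull′)
  open ≡-Reasoning

  cell : ∀ r c → hasS (B r c) ≡ hasS (B′ r c) → hasW (B r c) ≡ hasW (B′ r c) → B r c ≡ B′ r c
  cell r c S≡ W≡ with same-or-straight r c
  ... | inj₁ same = same
  ... | inj₂ (straight , straight′) = straight-determined-by-S-W straight straight′ S≡ W≡

  row-agrees : ∀ r → (∀ c → hasS (B r c) ≡ hasS (B′ r c)) → ∀ c → B r c ≡ B′ r c
  row-agrees r S≡ = upward-induction _
    (λ c c≡0 → cell r c (S≡ c) (trans (leftEmpty r c c≡0) (sym (leftEmpty′ r c c≡0))))
    (λ c′ c c′+1≡c ih → cell r c (S≡ c) (begin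
       hasW (B r c)    ≡⟨ horizMatch r c′ c (sym c′+1≡c) ⟨
       hasE (B r c′)   ≡⟨ cong hasE ih ⟩
       hasE (B′ r c′)  ≡⟨ horizMatch′ r c′ c (sym c′+1≡c) ⟩
       hasW (B′ r c)   ∎))

-- Grids prescribed by their edges

incoming : (ℕ → Bool) → ℕ → Bool
incoming f zero    = false
incoming f (suc k) = f k

incoming-cong : ∀ {f g : ℕ → Bool} → (∀ k → f k ≡ g k) →
  ∀ x → incoming f x ≡ incoming g x
incoming-cong f≗g zero    = refl
incoming-cong f≗g (suc k) = f≗g k

fromIndex : ℕ → ℕ → Bool
fromIndex y k = does (y ℕ.≤? k)

incoming-fromIndex : ∀ y x → y ≢ x → incoming (fromIndex y) x ≡ fromIndex y x
incoming-fromIndex y zero    y≢0   = sym (dec-false (y ℕ.≤? 0) λ y≤0 → y≢0 (ℕ.n≤0⇒n≡0 y≤0))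
incoming-fromIndex y (suc x) y≢x+1 =
  does-⇔ (mk⇔ ℕ.m≤n⇒m≤1+n λ y≤x+1 → ℕ.≤-pred (ℕ.≤∧≢⇒< y≤x+1 y≢x+1)) (y ℕ.≤? x) (y ℕ.≤? suc x)

incoming-fromIndex-self : ∀ y → incoming (fromIndex y) y ≡ false
incoming-fromIndex-self zero    = refl
incoming-fromIndex-self (suc y) = dec-false (suc y ℕ.≤? y) (ℕ.<-irrefl refl)

fromIndex-≤ : ∀ {y x} → y ℕ.≤ x → fromIndex y x ≡ true
fromIndex-≤ {y} {x} = dec-true (y ℕ.≤? x)

tileWith : (N S W E : Bool) → Tile
tileWith true  true  true  true  = cross
tileWith false false true  true  = horiz
tileWith true  true  false false = vert
tileWith false true  false true  = relbow
tileWith true  false true  false = jelbow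
tileWith _     _     _     _     = blank

data ValidEdges : (N S W E : Bool) → Set where
  edges-blank  : ValidEdges false false false false
  edges-cross  : ValidEdges true  true  true  true
  edges-horiz  : ValidEdges false false true  true
  edges-vert   : ValidEdges true  true  false false
  edges-relbow : ValidEdges false true  false true
  edges-jelbow : ValidEdges true  false true  false

record HasEdges (x : Tile) (N S W E : Bool) : Set where
  field
    N-edge : hasN x ≡ N
    S-edge : hasS x ≡ S
    W-edge : hasW x ≡ W
    E-edge : hasE x ≡ E

tileWith-hasEdges : ∀ {N S W E} → ValidEdges N S W E → HasEdges (tileWith N S W E) N S W E
tileWith-hasEdges edges-blank  = record { N-edge = refl ; S-edge = refl ; W-edge = refl ; E-edge = refl }
tileWith-hasEdges edges-cross  = record { N-edge = refl ; S-edge = refl ; W-edge = refl ; E-edge = refl }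
tileWith-hasEdges edges-horiz  = record { N-edge = refl ; S-edge = refl ; W-edge = refl ; E-edge = refl }
tileWith-hasEdges edges-vert   = record { N-edge = refl ; S-edge = refl ; W-edge = refl ; E-edge = refl }
tileWith-hasEdges edges-relbow = record { N-edge = refl ; S-edge = refl ; W-edge = refl ; E-edge = refl }
tileWith-hasEdges edges-jelbow = record { N-edge = refl ; S-edge = refl ; W-edge = refl ; E-edge = refl }

tileWith-edgesOf : ∀ x → tileWith (hasN x) (hasS x) (hasW x) (hasE x) ≡ x
tileWith-edgesOf blank  = refl
tileWith-edgesOf cross  = refl
tileWith-edgesOf horiz  = refl
tileWith-edgesOf vert   = refl
tileWith-edgesOf relbow = refl
tileWith-edgesOf jelbow = refl

validEdges-of : ∀ x → ValidEdges (hasN x) (hasS x) (hasW x) (hasE x)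
validEdges-of blank  = edges-blank
validEdges-of cross  = edges-cross
validEdges-of horiz  = edges-horiz
validEdges-of vert   = edges-vert
validEdges-of relbow = edges-relbow
validEdges-of jelbow = edges-jelbow

hasEdges⇒tileWith : ∀ {x N S W E} → HasEdges x N S W E → tileWith N S W E ≡ x
hasEdges⇒tileWith {x} record { N-edge = refl ; S-edge = refl ; W-edge = refl ; E-edge = refl } =
  tileWith-edgesOf x

hasEdges⇒valid : ∀ {x N S W E} → HasEdges x N S W E → ValidEdges N S W E
hasEdges⇒valid {x} record { N-edge = refl ; S-edge = refl ; W-edge = refl ; E-edge = refl } =
  validEdges-of x

validEdges-straight : ∀ {N S W E} → N ≡ S → W ≡ E → ValidEdges N S W E
validEdges-straight {N = false} {W = false} refl refl = edges-blank
validEdges-straight {N = false} {W = true}  refl refl = edges-horiz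
validEdges-straight {N = true}  {W = false} refl refl = edges-vert
validEdges-straight {N = true}  {W = true}  refl refl = edges-cross

tileWith-straight : ∀ {N S W E} → N ≡ S → W ≡ E → Straight (tileWith N S W E)
tileWith-straight {N = false} {W = false} refl refl = straight-blank
tileWith-straight {N = false} {W = true}  refl refl = straight-horiz
tileWith-straight {N = true}  {W = false} refl refl = straight-vert
tileWith-straight {N = true}  {W = true}  refl refl = straight-cross

-- Adjacent tiles of  grid  match automatically, since each interior edge is read off one label.
module EdgeLabelling {n : ℕ} (hor : Fin n → ℕ → Bool) (ver : ℕ → Fin n → Bool) where

  labelN labelS labelW labelE : Fin n → Fin n → Bool
  labelN r c = incoming (λ k → ver k c) (toℕ r)
  labelS r c = ver (toℕ r) c
  labelW r c = incoming (hor r) (toℕ c)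
  labelE r c = hor r (toℕ c)

  grid : Grid n
  grid r c = tileWith (labelN r c) (labelS r c) (labelW r c) (labelE r c)

  module _ (valid : ∀ r c → ValidEdges (labelN r c) (labelS r c) (labelW r c) (labelE r c)) where
    open HasEdges

    grid-hasEdges : ∀ r c → HasEdges (grid r c) (labelN r c) (labelS r c) (labelW r c) (labelE r c)
    grid-hasEdges r c = tileWith-hasEdges (valid r c)

    grid-isBPD : (∀ r c → suc (toℕ r) ≡ n → labelS r c ≡ true) →
                 (∀ r c → suc (toℕ c) ≡ n → labelE r c ≡ true) → IsBPD grid
    grid-isBPD bottom-open right-open = record
      { horizMatch = λ r c c′ c′≡c+1 → trans (E-edge (grid-hasEdges r c))
          (trans (cong (incoming (hor r)) (sym c′≡c+1)) (sym (W-edge (grid-hasEdges r c′))))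
      ; vertMatch  = λ r r′ c r′≡r+1 → trans (S-edge (grid-hasEdges r c))
          (trans (cong (incoming (λ k → ver k c)) (sym r′≡r+1)) (sym (N-edge (grid-hasEdges r′ c))))
      ; topEmpty   = λ r c r≡0 →
          trans (N-edge (grid-hasEdges r c)) (cong (incoming (λ k → ver k c)) r≡0)
      ; leftEmpty  = λ r c c≡0 →
          trans (W-edge (grid-hasEdges r c)) (cong (incoming (hor r)) c≡0)
      ; bottomFull = λ r c r-last → trans (S-edge (grid-hasEdges r c)) (bottom-open r c r-last)
      ; rightFull  = λ r c c-last → trans (E-edge (grid-hasEdges r c)) (right-open r c c-last)
      }

Greatest : ∀ {m} → (Fin m → Set) → Set
Greatest P = ∃ λ i → P i × ∀ k → P k → k ≤ i

greatest-or-none : ∀ {m} (P : Fin m → Set) → (∀ i → Dec (P i)) → Greatest P ⊎ (∀ k → ¬ P k)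
greatest-or-none {zero}  P P? = inj₂ λ ()
greatest-or-none {suc m} P P? with greatest-or-none (P ∘ fsuc) (P? ∘ fsuc) | P? fzero
... | inj₁ (i , Pi , max) | _ = inj₁ (fsuc i , Pi , max′)
  where
  max′ : ∀ k → P k → k ≤ fsuc i
  max′ fzero    _  = z≤n
  max′ (fsuc k) Pk = s≤s (max k Pk)
... | inj₂ none | yes P0 = inj₁ (fzero , P0 , max′)
  where
  max′ : ∀ k → P k → k ≤ fzero {m}
  max′ fzero    _  = z≤n
  max′ (fsuc k) Pk = ⊥-elim (none k Pk)
... | inj₂ none | no ¬P0 = inj₂ none′
  where
  none′ : ∀ k → ¬ P k
  none′ fzero    = ¬P0
  none′ (fsuc k) = none k

module _ {m : ℕ} (P : Fin m → Set) (P? : ∀ i → Dec (P i)) where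

  valueAtGreatest : (Fin m → Bool) → Bool
  valueAtGreatest g with greatest-or-none P P?
  ... | inj₁ (i , _) = g i
  ... | inj₂ _       = false

  valueAtGreatest-≡ : ∀ g i → P i → (∀ k → P k → k ≤ i) → valueAtGreatest g ≡ g i
  valueAtGreatest-≡ g i Pi max with greatest-or-none P P?
  ... | inj₁ (i′ , Pi′ , max′) = cong g (≤-antisym (max i′ Pi′) (max′ i Pi))
  ... | inj₂ none              = ⊥-elim (none i Pi)

  valueAtGreatest-none : ∀ g → (∀ k → ¬ P k) → valueAtGreatest g ≡ false
  valueAtGreatest-none g none with greatest-or-none P P?
  ... | inj₁ (i , Pi , _) = ⊥-elim (none i Pi)
  ... | inj₂ _            = refl

valueAtGreatest-cong : ∀ {m} (P Q : Fin m → Set) (P? : ∀ i → Dec (P i)) (Q? : ∀ i → Dec (Q i)) g →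
  (∀ i → P i → Q i) → (∀ i → Q i → P i) → valueAtGreatest P P? g ≡ valueAtGreatest Q Q? g
valueAtGreatest-cong P Q P? Q? g P⇒Q Q⇒P with greatest-or-none Q Q?
... | inj₁ (i , Qi , max) = valueAtGreatest-≡ P P? g i (Q⇒P i Qi) λ k Pk → max k (P⇒Q k Pk)
... | inj₂ none           = valueAtGreatest-none P P? g λ k Pk → none k (P⇒Q k Pk)

module LastInImage {m n : ℕ} (f : Fin m → Fin n) (f-inc : StrictlyIncreasing f) where
  private module F = StrictlyIncreasingMap f f-inc

  lastValue : (Fin m → Bool) → ℕ → Bool
  lastValue g x = valueAtGreatest (λ i → toℕ (f i) ℕ.≤ x) (λ i → toℕ (f i) ℕ.≤? x) g

  lastValue-at-image : ∀ g i → lastValue g (toℕ (f i)) ≡ g i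
  lastValue-at-image g i = valueAtGreatest-≡ _ _ g i ℕ.≤-refl λ k → F.reflects-≤

  lastValue-off-image : ∀ g x → (∀ i → toℕ (f i) ≢ x) → incoming (lastValue g) x ≡ lastValue g x
  lastValue-off-image g zero    fi≢0   =
    sym (valueAtGreatest-none _ _ g λ k fk≤0 → fi≢0 k (ℕ.n≤0⇒n≡0 fk≤0))
  lastValue-off-image g (suc x) fi≢x+1 = valueAtGreatest-cong _ _ _ _ g
    (λ i → ℕ.m≤n⇒m≤1+n) (λ i fi≤x+1 → ℕ.≤-pred (ℕ.≤∧≢⇒< fi≤x+1 (fi≢x+1 i)))

  incoming-lastValue-first : ∀ g i → toℕ i ≡ 0 → incoming (lastValue g) (toℕ (f i)) ≡ false
  incoming-lastValue-first g i i≡0 with toℕ (f i) in fi≡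
  ... | zero  = refl
  ... | suc x = valueAtGreatest-none _ _ g λ k fk≤x →
    ℕ.n≮0 (subst (toℕ k ℕ.<_) i≡0 (F.reflects-< (subst (toℕ (f k) ℕ.<_) (sym fi≡) (s≤s fk≤x))))

  incoming-lastValue-step : ∀ g i′ i → suc (toℕ i′) ≡ toℕ i →
    incoming (lastValue g) (toℕ (f i)) ≡ g i′
  incoming-lastValue-step g i′ i i′+1≡i with toℕ (f i) in fi≡ | f-inc i′ i (ℕ.≤-reflexive i′+1≡i)
  ... | zero  | fi′<fi = ⊥-elim (ℕ.n≮0 fi′<fi)
  ... | suc x | fi′<fi = valueAtGreatest-≡ _ _ g i′ (ℕ.≤-pred fi′<fi) λ k fk≤x →
    ℕ.≤-pred (subst (suc (toℕ k) ℕ.≤_) (sym i′+1≡i)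
      (F.reflects-< (subst (toℕ (f k) ℕ.<_) (sym fi≡) (s≤s fk≤x))))

  lastValue-beyond-image : ∀ g x l → suc (toℕ l) ≡ m → (∀ i → toℕ (f i) ℕ.≤ x) →
    lastValue g x ≡ g l
  lastValue-beyond-image g x l l-last below =
    valueAtGreatest-≡ _ _ g l (below l) λ k _ → ≤-last l-last k

-- The bijection φ

module Subword {n m : ℕ} (w : Fin n → Fin n) (w-perm : IsPerm w)
  {s : Fin m → Fin n} (s-inc : StrictlyIncreasing s)
  {t : Fin m → Fin n} (t-sorted : IsSortedEntries (λ k → w (s k)) t)
  {u : Fin m → Fin m} (u-std : IsStandardization (λ k → w (s k)) u) where

  t-inc : StrictlyIncreasing t
  t-inc = proj₁ t-sorted

  private
    module S = StrictlyIncreasingMap s s-inc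
    module T = StrictlyIncreasingMap t t-inc

  v-injective : ∀ {a b} → w (s a) ≡ w (s b) → a ≡ b
  v-injective = S.injective ∘ w-perm

  rank : Fin m → Fin m
  rank k = proj₁ (proj₂ (proj₂ t-sorted) k)

  v≡t∘rank : ∀ k → w (s k) ≡ t (rank k)
  v≡t∘rank k = proj₂ (proj₂ (proj₂ t-sorted) k)

  u-injective : Injective _≡_ _≡_ u
  u-injective {a} {b} ua≡ub with <-cmp (w (s a)) (w (s b))
  ... | tri< va<vb _ _ = ⊥-elim (ℕ.<-irrefl (cong toℕ ua≡ub) (Equivalence.from (u-std a b) va<vb))
  ... | tri≈ _ va≡vb _ = v-injective va≡vb
  ... | tri> _ _ vb<va = ⊥-elim (ℕ.<-irrefl (cong toℕ (sym ua≡ub)) (Equivalence.from (u-std b a) vb<va))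

  rank≗u : ∀ k → rank k ≡ u k
  rank≗u = same-order⇒≗ rank u rank-injective u-injective
    (λ a b ra<rb → Equivalence.from (u-std a b)
      (subst₂ _<_ (sym (v≡t∘rank a)) (sym (v≡t∘rank b)) (t-inc _ _ ra<rb)))
    (λ a b ua<ub → T.reflects-<
      (subst₂ _<_ (v≡t∘rank a) (v≡t∘rank b) (Equivalence.to (u-std a b) ua<ub)))
    where
    rank-injective : Injective _≡_ _≡_ rank
    rank-injective {a} {b} ra≡rb =
      v-injective (trans (v≡t∘rank a) (trans (cong t ra≡rb) (sym (v≡t∘rank b))))

  v≡t∘u : ∀ k → w (s k) ≡ t (u k)
  v≡t∘u k = trans (v≡t∘rank k) (cong t (rank≗u k))

  KeptRow KeptColumn : Fin n → Set
  KeptRow r = ∃ λ i → s i ≡ r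
  KeptColumn c = ∃ λ j → t j ≡ c

  keptRow? : ∀ r → Dec (KeptRow r)
  keptRow? r = any? λ i → s i ≟ r

  keptColumn? : ∀ c → Dec (KeptColumn c)
  keptColumn? c = any? λ j → t j ≟ c

  w⁻¹ : Fin n → Fin n
  w⁻¹ c = proj₁ (injective⇒surjective w w-perm c)

  w∘w⁻¹ : ∀ c → w (w⁻¹ c) ≡ c
  w∘w⁻¹ c = proj₂ (injective⇒surjective w w-perm c)

  w⁻¹∘w : ∀ r → w⁻¹ (w r) ≡ r
  w⁻¹∘w r = w-perm (w∘w⁻¹ (w r))

  kept-column≢w-deleted-row : ∀ j r → ¬ KeptRow r → t j ≢ w r
  kept-column≢w-deleted-row j r r-deleted tj≡wr with proj₁ (proj₂ t-sorted) j
  ... | k , vk≡tj = r-deleted (k , w-perm (trans vk≡tj tj≡wr))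

  deleted-column≢w-kept-row : ∀ i c → ¬ KeptColumn c → c ≢ w (s i)
  deleted-column≢w-kept-row i c c-deleted c≡wsi = c-deleted (u i , trans (sym (v≡t∘u i)) (sym c≡wsi))

  w-deleted-row-deleted : ∀ r → ¬ KeptRow r → ¬ KeptColumn (w r)
  w-deleted-row-deleted r r-deleted (j , tj≡wr) = kept-column≢w-deleted-row j r r-deleted tj≡wr

  w⁻¹-deleted-column-deleted : ∀ c → ¬ KeptColumn c → ¬ KeptRow (w⁻¹ c)
  w⁻¹-deleted-column-deleted c c-deleted (k , sk≡w⁻¹c) =
    c-deleted (rank k , trans (sym (v≡t∘rank k)) (trans (cong w sk≡w⁻¹c) (w∘w⁻¹ c)))

  module _ {B : Grid n} (B∈ : InBPDsub w s B) where
    private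
      bpd : IsBPD B
      bpd = proj₁ (proj₁ B∈)
      open BPDProperties B bpd

    deleted⇒removable : ∀ x → ¬ KeptRow x → Removable B w x
    deleted⇒removable x = Equivalence.from (proj₂ B∈ x)

    straight-in-deleted-row-off-w : ∀ r c → ¬ KeptRow r → c ≢ w r → Straight (B r c)
    straight-in-deleted-row-off-w r c r-deleted =
      straight-off-unique-relbow-in-row r (w r) (proj₁ (proj₂ (deleted⇒removable r r-deleted))) c

    straight-in-deleted-row : ∀ r j → ¬ KeptRow r → Straight (B r (t j))
    straight-in-deleted-row r j r-deleted =
      straight-in-deleted-row-off-w r (t j) r-deleted (kept-column≢w-deleted-row j r r-deleted)

    straight-in-deleted-column : ∀ i c → ¬ KeptColumn c → Straight (B (s i) c)
    straight-in-deleted-column i c c-deleted = subst (λ c → Straight (B (s i) c)) (w∘w⁻¹ c)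
      (straight-off-unique-relbow-in-column (w (w⁻¹ c)) (w⁻¹ c) column-unique (s i)
        λ si≡w⁻¹c → w⁻¹c-deleted (i , si≡w⁻¹c))
      where
      w⁻¹c-deleted = w⁻¹-deleted-column-deleted c c-deleted
      column-unique = proj₂ (proj₂ (deleted⇒removable (w⁻¹ c) w⁻¹c-deleted))

    open Compression B bpd s-inc t-inc straight-in-deleted-row straight-in-deleted-column

    φ-hasPerm : HasPerm (φ s t B) u
    φ-hasPerm i with BPDProperties.pipe-exists (φ s t B) φ-isBPD (u i)
    ... | i′ , pipe
        with pipe-source-unique (lift-pipe (φ s t B) (λ _ _ → refl) pipe) (proj₂ (proj₁ B∈) (s i′))
    ... | tui≡wsi′ with u-injective (T.injective (trans tui≡wsi′ (v≡t∘u i′)))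
    ... | refl = pipe

    φ-minimal : ∀ i → ¬ Removable (φ s t B) u i
    φ-minimal i (relbow-at , row-unique , column-unique) =
      Equivalence.to (proj₂ B∈ (s i)) removable (i , refl)
      where
      row-unique′ : ∀ c → B (s i) c ≡ relbow → c ≡ w (s i)
      row-unique′ c relbow-at-c with keptColumn? c
      ... | no c-deleted   =
        ⊥-elim (straight⇒≢relbow (straight-in-deleted-column i c c-deleted) relbow-at-c)
      ... | yes (j , refl) = trans (cong t (row-unique j relbow-at-c)) (sym (v≡t∘u i))
      column-unique′ : ∀ r → B r (w (s i)) ≡ relbow → r ≡ s i
      column-unique′ r relbow-at-r
        with keptRow? r | subst (λ c → B r c ≡ relbow) (v≡t∘u i) relbow-at-r
      ... | no r-deleted   | relbow-at-r′ =
        ⊥-elim (straight⇒≢relbow (straight-in-deleted-row r (u i) r-deleted) relbow-at-r′)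
      ... | yes (k , refl) | relbow-at-r′ = cong s (column-unique k relbow-at-r′)
      removable : Removable B w (s i)
      removable =
        subst (λ c → B (s i) c ≡ relbow) (sym (v≡t∘u i)) relbow-at , row-unique′ , column-unique′

    φ-inMBPD : InMBPD u (φ s t B)
    φ-inMBPD = (φ-isBPD , φ-hasPerm) , φ-minimal

  φ-injective : ∀ {B B′} → InBPDsub w s B → InBPDsub w s B′ → φ s t B ≐ φ s t B′ → B ≐ B′
  φ-injective {B} {B′} B∈ B′∈ φ≐ =
    ≐-if-equal-or-straight (proj₁ (proj₁ B∈)) (proj₁ (proj₁ B′∈)) equal-or-straight
    where
    equal-or-straight : ∀ r c → B r c ≡ B′ r c ⊎ Straight (B r c) × Straight (B′ r c)
    equal-or-straight r c with keptRow? r | keptColumn? c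
    ... | yes (i , refl) | yes (j , refl) = inj₁ (φ≐ i j)
    ... | yes (i , refl) | no c-deleted   =
      inj₂ (straight-in-deleted-column B∈ i c c-deleted , straight-in-deleted-column B′∈ i c c-deleted)
    ... | no r-deleted | _ with c ≟ w r
    ...   | yes refl = inj₁ (trans (proj₁ (deleted⇒removable B∈ r r-deleted))
                                   (sym (proj₁ (deleted⇒removable B′∈ r r-deleted))))
    ...   | no c≢wr  = inj₂ (straight-in-deleted-row-off-w B∈ r c r-deleted c≢wr ,
                             straight-in-deleted-row-off-w B′∈ r c r-deleted c≢wr)

  module HookInsertion {C : Grid m} (C∈ : InMBPD u C) where
    private
      C-bpd : IsBPD C
      C-bpd = proj₁ (proj₁ C∈)
      module C = IsBPD C-bpd
      module SL = LastInImage s s-inc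
      module TL = LastInImage t t-inc

    southEdges eastEdges : Fin m → Fin m → Bool
    southEdges j i = hasS (C i j)
    eastEdges i j = hasE (C i j)

    -- A deleted row  r  receives the hook of the removable pipe  w r → r : it runs up column  w r
    -- from the bottom edge to row  r , then along row  r  to the right edge.
    hor : Fin n → ℕ → Bool
    hor r k with keptRow? r
    ... | yes (i , _) = TL.lastValue (eastEdges i) k
    ... | no _        = fromIndex (toℕ (w r)) k

    ver : ℕ → Fin n → Bool
    ver k c with keptColumn? c
    ... | yes (j , _) = SL.lastValue (southEdges j) k
    ... | no _        = fromIndex (toℕ (w⁻¹ c)) k

    open EdgeLabelling hor ver public

    hor-kept : ∀ i k → hor (s i) k ≡ TL.lastValue (eastEdges i) k
    hor-kept i k with keptRow? (s i)
    ... | yes (i′ , si′≡si) = cong (λ i → TL.lastValue (eastEdges i) k) (S.injective si′≡si)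
    ... | no si-deleted     = ⊥-elim (si-deleted (i , refl))

    hor-deleted : ∀ r k → ¬ KeptRow r → hor r k ≡ fromIndex (toℕ (w r)) k
    hor-deleted r k r-deleted with keptRow? r
    ... | yes r-kept = ⊥-elim (r-deleted r-kept)
    ... | no _       = refl

    ver-kept : ∀ k j → ver k (t j) ≡ SL.lastValue (southEdges j) k
    ver-kept k j with keptColumn? (t j)
    ... | yes (j′ , tj′≡tj) = cong (λ j → SL.lastValue (southEdges j) k) (T.injective tj′≡tj)
    ... | no tj-deleted     = ⊥-elim (tj-deleted (j , refl))

    ver-deleted : ∀ k c → ¬ KeptColumn c → ver k c ≡ fromIndex (toℕ (w⁻¹ c)) k
    ver-deleted k c c-deleted with keptColumn? c
    ... | yes c-kept = ⊥-elim (c-deleted c-kept)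
    ... | no _       = refl

    N≡S-in-kept-column : ∀ r j → ¬ KeptRow r → labelN r (t j) ≡ labelS r (t j)
    N≡S-in-kept-column r j r-deleted = begin
      incoming (λ k → ver k (t j)) (toℕ r)            ≡⟨ incoming-cong (λ k → ver-kept k j) (toℕ r) ⟩
      incoming (SL.lastValue (southEdges j)) (toℕ r)  ≡⟨ SL.lastValue-off-image _ _ r∉s ⟩
      SL.lastValue (southEdges j) (toℕ r)             ≡⟨ ver-kept (toℕ r) j ⟨
      ver (toℕ r) (t j)                               ∎
      where
      open ≡-Reasoning
      r∉s : ∀ i → toℕ (s i) ≢ toℕ r
      r∉s i si≡r = r-deleted (i , toℕ-injective si≡r)

    N≡S-in-deleted-column : ∀ r c → ¬ KeptColumn c → w⁻¹ c ≢ r → labelN r c ≡ labelS r c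
    N≡S-in-deleted-column r c c-deleted w⁻¹c≢r = begin
      incoming (λ k → ver k c) (toℕ r)           ≡⟨ incoming-cong (λ k → ver-deleted k c c-deleted) (toℕ r) ⟩
      incoming (fromIndex (toℕ (w⁻¹ c))) (toℕ r) ≡⟨ incoming-fromIndex _ _ (w⁻¹c≢r ∘ toℕ-injective) ⟩
      fromIndex (toℕ (w⁻¹ c)) (toℕ r)            ≡⟨ ver-deleted (toℕ r) c c-deleted ⟨
      ver (toℕ r) c                              ∎
      where open ≡-Reasoning

    W≡E-in-kept-row : ∀ i c → ¬ KeptColumn c → labelW (s i) c ≡ labelE (s i) c
    W≡E-in-kept-row i c c-deleted = begin
      incoming (hor (s i)) (toℕ c)                   ≡⟨ incoming-cong (hor-kept i) (toℕ c) ⟩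
      incoming (TL.lastValue (eastEdges i)) (toℕ c)  ≡⟨ TL.lastValue-off-image _ _ c∉t ⟩
      TL.lastValue (eastEdges i) (toℕ c)             ≡⟨ hor-kept i (toℕ c) ⟨
      hor (s i) (toℕ c)                              ∎
      where
      open ≡-Reasoning
      c∉t : ∀ j → toℕ (t j) ≢ toℕ c
      c∉t j tj≡c = c-deleted (j , toℕ-injective tj≡c)

    W≡E-in-deleted-row : ∀ r c → ¬ KeptRow r → c ≢ w r → labelW r c ≡ labelE r c
    W≡E-in-deleted-row r c r-deleted c≢wr = begin
      incoming (hor r) (toℕ c)                 ≡⟨ incoming-cong (λ k → hor-deleted r k r-deleted) (toℕ c) ⟩
      incoming (fromIndex (toℕ (w r))) (toℕ c) ≡⟨ incoming-fromIndex _ _ (c≢wr ∘ toℕ-injective ∘ sym) ⟩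
      fromIndex (toℕ (w r)) (toℕ c)            ≡⟨ hor-deleted r (toℕ c) r-deleted ⟨
      hor r (toℕ c)                            ∎
      where open ≡-Reasoning

    kept-cell-edges : ∀ i j → HasEdges (C i j)
      (labelN (s i) (t j)) (labelS (s i) (t j)) (labelW (s i) (t j)) (labelE (s i) (t j))
    kept-cell-edges i j = record
      { N-edge = sym (trans (incoming-cong (λ k → ver-kept k j) (toℕ (s i))) N-from-C)
      ; S-edge = sym (trans (ver-kept _ j) (SL.lastValue-at-image _ i))
      ; W-edge = sym (trans (incoming-cong (hor-kept i) (toℕ (t j))) W-from-C)
      ; E-edge = sym (trans (hor-kept i _) (TL.lastValue-at-image _ j))
      }
      where
      N-from-C : incoming (SL.lastValue (southEdges j)) (toℕ (s i)) ≡ hasN (C i j)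
      N-from-C with predecessor i
      ... | inj₁ i≡0           =
        trans (SL.incoming-lastValue-first _ i i≡0) (sym (C.topEmpty i j i≡0))
      ... | inj₂ (i′ , i′+1≡i) =
        trans (SL.incoming-lastValue-step _ i′ i i′+1≡i) (C.vertMatch i′ i j (sym i′+1≡i))
      W-from-C : incoming (TL.lastValue (eastEdges i)) (toℕ (t j)) ≡ hasW (C i j)
      W-from-C with predecessor j
      ... | inj₁ j≡0           =
        trans (TL.incoming-lastValue-first _ j j≡0) (sym (C.leftEmpty i j j≡0))
      ... | inj₂ (j′ , j′+1≡j) =
        trans (TL.incoming-lastValue-step _ j′ j j′+1≡j) (C.horizMatch i j′ j (sym j′+1≡j))

    hook-corner-edges : ∀ r → ¬ KeptRow r →
      HasEdges relbow (labelN r (w r)) (labelS r (w r)) (labelW r (w r)) (labelE r (w r))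
    hook-corner-edges r r-deleted = record
      { N-edge = sym (begin
          incoming (λ k → ver k (w r)) (toℕ r)
            ≡⟨ incoming-cong (λ k → ver-deleted k (w r) wr-deleted) (toℕ r) ⟩
          incoming (fromIndex (toℕ (w⁻¹ (w r)))) (toℕ r)
            ≡⟨ cong (λ y → incoming (fromIndex (toℕ y)) (toℕ r)) (w⁻¹∘w r) ⟩
          incoming (fromIndex (toℕ r)) (toℕ r)
            ≡⟨ incoming-fromIndex-self (toℕ r) ⟩
          false
            ∎)
      ; S-edge = sym (trans (ver-deleted _ (w r) wr-deleted)
                            (fromIndex-≤ (ℕ.≤-reflexive (cong toℕ (w⁻¹∘w r)))))
      ; W-edge = sym (trans (incoming-cong (λ k → hor-deleted r k r-deleted) (toℕ (w r)))
                            (incoming-fromIndex-self (toℕ (w r))))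
      ; E-edge = sym (trans (hor-deleted r _ r-deleted) (fromIndex-≤ {toℕ (w r)} ℕ.≤-refl))
      }
      where
      open ≡-Reasoning
      wr-deleted = w-deleted-row-deleted r r-deleted

    N≡S-off-hooks : ∀ r c → ¬ KeptRow r ⊎ ¬ KeptColumn c → c ≢ w r → labelN r c ≡ labelS r c
    N≡S-off-hooks r c deleted c≢wr = by-cases (keptColumn? c)
      where
      by-cases : Dec (KeptColumn c) → labelN r c ≡ labelS r c
      by-cases (no c-deleted) = N≡S-in-deleted-column r c c-deleted
        λ w⁻¹c≡r → c≢wr (trans (sym (w∘w⁻¹ c)) (cong w w⁻¹c≡r))
      by-cases (yes c-kept@(j , tj≡c)) = subst (λ c → labelN r c ≡ labelS r c) tj≡c
        (N≡S-in-kept-column r j (fromInj₁ (λ c-deleted → ⊥-elim (c-deleted c-kept)) deleted))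

    W≡E-off-hooks : ∀ r c → ¬ KeptRow r ⊎ ¬ KeptColumn c → c ≢ w r → labelW r c ≡ labelE r c
    W≡E-off-hooks r c deleted c≢wr = by-cases (keptRow? r)
      where
      by-cases : Dec (KeptRow r) → labelW r c ≡ labelE r c
      by-cases (no r-deleted) = W≡E-in-deleted-row r c r-deleted c≢wr
      by-cases (yes r-kept@(i , si≡r)) = subst (λ r → labelW r c ≡ labelE r c) si≡r
        (W≡E-in-kept-row i c (fromInj₂ (λ r-deleted → ⊥-elim (r-deleted r-kept)) deleted))

    valid : ∀ r c → ValidEdges (labelN r c) (labelS r c) (labelW r c) (labelE r c)
    valid r c = by-cases (keptRow? r) (keptColumn? c)
      where
      Valid : Fin n → Fin n → Set
      Valid r c = ValidEdges (labelN r c) (labelS r c) (labelW r c) (labelE r c)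
      off-hooks : ¬ KeptRow r ⊎ ¬ KeptColumn c → c ≢ w r → Valid r c
      off-hooks deleted c≢wr =
        validEdges-straight (N≡S-off-hooks r c deleted c≢wr) (W≡E-off-hooks r c deleted c≢wr)
      by-cases : Dec (KeptRow r) → Dec (KeptColumn c) → Valid r c
      by-cases (yes (i , si≡r)) (yes (j , tj≡c)) =
        subst₂ Valid si≡r tj≡c (hasEdges⇒valid (kept-cell-edges i j))
      by-cases (yes (i , si≡r)) (no c-deleted) = off-hooks (inj₂ c-deleted)
        λ c≡wr → deleted-column≢w-kept-row i c c-deleted (trans c≡wr (cong w (sym si≡r)))
      by-cases (no r-deleted) _ with c ≟ w r
      ... | yes c≡wr = subst (Valid r) (sym c≡wr) (hasEdges⇒valid (hook-corner-edges r r-deleted))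
      ... | no c≢wr  = off-hooks (inj₁ r-deleted) c≢wr

    straight-off-hooks : ∀ r c → ¬ KeptRow r ⊎ ¬ KeptColumn c → c ≢ w r → Straight (grid r c)
    straight-off-hooks r c deleted c≢wr =
      tileWith-straight (N≡S-off-hooks r c deleted c≢wr) (W≡E-off-hooks r c deleted c≢wr)

    hook-corner : ∀ r → ¬ KeptRow r → grid r (w r) ≡ relbow
    hook-corner r r-deleted = hasEdges⇒tileWith (hook-corner-edges r r-deleted)

    kept-cell : φ s t grid ≐ C
    kept-cell i j = hasEdges⇒tileWith (kept-cell-edges i j)

    bottom-open : ∀ r c → suc (toℕ r) ≡ n → labelS r c ≡ true
    bottom-open r c r-last = by-cases (keptColumn? c)
      where
      by-cases : Dec (KeptColumn c) → labelS r c ≡ true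
      by-cases (no c-deleted) = trans (ver-deleted _ c c-deleted) (fromIndex-≤ (≤-last r-last (w⁻¹ c)))
      by-cases (yes (j , tj≡c)) with lastIndex j
      ... | l , l-last = subst (λ c → labelS r c ≡ true) tj≡c (begin
        ver (toℕ r) (t j)                   ≡⟨ ver-kept _ j ⟩
        SL.lastValue (southEdges j) (toℕ r) ≡⟨ SL.lastValue-beyond-image _ _ l l-last below-r ⟩
        hasS (C l j)                        ≡⟨ C.bottomFull l j l-last ⟩
        true                                ∎)
        where
        open ≡-Reasoning
        below-r : ∀ i → toℕ (s i) ℕ.≤ toℕ r
        below-r i = ≤-last r-last (s i)

    right-open : ∀ r c → suc (toℕ c) ≡ n → labelE r c ≡ true
    right-open r c c-last = by-cases (keptRow? r)
      where
      by-cases : Dec (KeptRow r) → labelE r c ≡ true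
      by-cases (no r-deleted) = trans (hor-deleted r _ r-deleted) (fromIndex-≤ (≤-last c-last (w r)))
      by-cases (yes (i , si≡r)) with lastIndex i
      ... | l , l-last = subst (λ r → labelE r c ≡ true) si≡r (begin
        hor (s i) (toℕ c)                  ≡⟨ hor-kept i _ ⟩
        TL.lastValue (eastEdges i) (toℕ c) ≡⟨ TL.lastValue-beyond-image _ _ l l-last left-of-c ⟩
        hasE (C i l)                       ≡⟨ C.rightFull i l l-last ⟩
        true                               ∎)
        where
        open ≡-Reasoning
        left-of-c : ∀ j → toℕ (t j) ℕ.≤ toℕ c
        left-of-c j = ≤-last c-last (t j)

    grid-bpd : IsBPD grid
    grid-bpd = grid-isBPD valid bottom-open right-open

    open BPDProperties grid grid-bpd
    open Compression grid grid-bpd s-inc t-inc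
      (λ r j r-deleted →
        straight-off-hooks r (t j) (inj₁ r-deleted) (kept-column≢w-deleted-row j r r-deleted))
      (λ i c c-deleted →
        straight-off-hooks (s i) c (inj₂ c-deleted) (deleted-column≢w-kept-row i c c-deleted))

    grid-hasPerm : HasPerm grid w
    grid-hasPerm r = by-cases (keptRow? r)
      where
      by-cases : Dec (KeptRow r) → Pipe grid (w r) r
      by-cases (yes (i , si≡r)) = subst (λ r → Pipe grid (w r) r) si≡r
        (subst (λ j → Pipe grid j (s i)) (sym (v≡t∘u i))
          (lift-pipe C kept-cell (proj₂ (proj₁ C∈) i)))
      by-cases (no r-deleted) = exit-east (w r) (enter-from-bottom (w r) r below) turn-east right
        where
        below : ∀ r′ → r < r′ → Straight (grid r′ (w r))
        below r′ r<r′ = straight-off-hooks r′ (w r) (inj₂ (w-deleted-row-deleted r r-deleted))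
          λ wr≡wr′ → ℕ.<-irrefl (cong toℕ (w-perm wr≡wr′)) r<r′
        turn-east : out (grid r (w r)) fromS ≡ just east
        turn-east = cong (λ x → out x fromS) (hook-corner r r-deleted)
        right : ∀ c → w r < c → Straight (grid r c)
        right c wr<c = straight-off-hooks r c (inj₁ r-deleted)
          λ c≡wr → ℕ.<-irrefl (cong toℕ (sym c≡wr)) wr<c

    removable⇒C-removable : ∀ i → Removable grid w (s i) → Removable C u i
    removable⇒C-removable i (relbow-at , row-unique , column-unique) =
      trans (sym (kept-cell i (u i))) (subst (λ c → grid (s i) c ≡ relbow) (v≡t∘u i) relbow-at) ,
      (λ j relbow-at-j → T.injective
        (trans (row-unique (t j) (trans (kept-cell i j) relbow-at-j)) (v≡t∘u i))) ,
      (λ k relbow-at-k → S.injective (column-unique (s k)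
        (subst (λ c → grid (s k) c ≡ relbow) (sym (v≡t∘u i))
          (trans (kept-cell k (u i)) relbow-at-k))))

    removable⇔deleted : ∀ x → Removable grid w x ⇔ (¬ ∃ λ k → s k ≡ x)
    removable⇔deleted x = mk⇔ removable⇒deleted deleted⇒removable′
      where
      removable⇒deleted : Removable grid w x → ¬ KeptRow x
      removable⇒deleted removable (i , refl) = proj₂ C∈ i (removable⇒C-removable i removable)
      deleted⇒removable′ : ¬ KeptRow x → Removable grid w x
      deleted⇒removable′ x-deleted = hook-corner x x-deleted , row-unique , column-unique
        where
        row-unique : ∀ c → grid x c ≡ relbow → c ≡ w x
        row-unique c relbow-at with c ≟ w x
        ... | yes c≡wx = c≡wx
        ... | no c≢wx  = ⊥-elim (straight⇒≢relbow (straight-off-hooks x c (inj₁ x-deleted) c≢wx) relbow-at)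
        column-unique : ∀ r → grid r (w x) ≡ relbow → r ≡ x
        column-unique r relbow-at with r ≟ x
        ... | yes r≡x = r≡x
        ... | no r≢x  = ⊥-elim (straight⇒≢relbow
          (straight-off-hooks r (w x) (inj₂ (w-deleted-row-deleted x x-deleted)) (r≢x ∘ w-perm ∘ sym))
          relbow-at)

  φ-surjective : ∀ C → InMBPD u C → Σ (Grid n) λ B → InBPDsub w s B × φ s t B ≐ C
  φ-surjective C C∈ = grid , ((grid-bpd , grid-hasPerm) , removable⇔deleted) , kept-cell
    where open HookInsertion C∈

mainTheorem2 : (n m : ℕ) (w : Fin n → Fin n) → IsPerm w →
    (s : Fin m → Fin n) → StrictlyIncreasing s →
    (t : Fin m → Fin n) → IsSortedEntries (λ k → w (s k)) t →
    (u : Fin m → Fin m) → IsStandardization (λ k → w (s k)) u →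
    ((B : Grid n) → InBPDsub w s B → InMBPD u (φ s t B)) ×
    ((B B' : Grid n) → InBPDsub w s B → InBPDsub w s B' →
      φ s t B ≐ φ s t B' → B ≐ B') ×
    ((C : Grid m) → InMBPD u C →
      Σ (Grid n) λ B → InBPDsub w s B × φ s t B ≐ C)
mainTheorem2 n m w w-perm s s-inc t t-sorted u u-std =
  (λ B → φ-inMBPD) , (λ B B′ → φ-injective) , φ-surjective
  where open Subword w w-perm s-inc t-sorted u-std
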